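{- For all nonnegative integers $\tau_1,\tau_2,\tau_3,\tau_4,\mu,\iota$ and nonnegative integers $n,k$: (i) $f(\tau_1,\tau_2,\tau_3,\tau_4,\mu,\iota)\le\max\big(f(\tau_1+\tau_2,0,\tau_3,\tau_4,\mu,\iota),\,f(0,\tau_1+\tau_2,\tau_3,\tau_4,\mu,\iota)\big)$, with equality only if $\tau_1=0$ or $\tau_2=0$. (ii) If $\iota\ge4$, then $f(\tau_1,\tau_2,\tau_3,\tau_4,\mu,\iota)\le f(\tau_1,\tau_2+\tau_3,0,\tau_4,\mu,\iota)$, with equality only if $\tau_3=0$. (iii) If $n\ge3k+2$, then \[\max_{(\tau_1,\tau_2,0,0,\mu,\iota)\in F(n,k)}\big(f(\tau_1,\tau_2,0,0,\mu,\iota)+\iota\mu+\mu^2\big)=\max_{j} e\big(E_j(n,k)\big),\] the maximum on the right being over those $j\in\{1,2,3\}$ for which $E_j(n,k)$ is defined. (iv) If $n\ge3k+21$, then \[\max_{(\tau_1,\tau_2,\tau_3,0,\mu,\iota)\in F(n,k)}\big(f(\tau_1,\tau_2,\tau_3,0,\mu,\iota)+\iota\mu+\mu^2\big)=\max_{j} e\big(E_j(n,k)\big),\] the maximum on the right being over those $j\in\{1,2,3\}$ for which $E_j(n,k)$ is defined.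
   Context: $F(n,k)$ is the set of $(\tau_1,\tau_2,\tau_3,\tau_4,\mu,\iota)\in\mathbb N_0^6$ with $\tau_1+\tau_2+\tau_3+\tau_4=k$ and $2\mu+\iota=n-3k$. Define $f'(\tau_1,\dots,\tau_4,\mu,\iota)=4\mu\tau_1+2\iota\tau_1+7\binom{\tau_1}{2}+3\tau_1+2\iota\tau_2+8\binom{\tau_2}{2}+3\tau_2+8\binom{\tau_3}{2}+8\tau_3\tau_4+3\tau_3+7\tau_1\tau_2+(2+3\mu)\tau_2+7\tau_1(\tau_3+\tau_4)+(3+3\mu)\tau_3+8\tau_2(\tau_3+\tau_4)+(2+\iota)\tau_3$, and $f=f'$ if $\mu\ge1,\iota\ge1$; $f=f'-(2\tau_2+3\tau_3)$ if $\mu=0,\iota\ge1$; $f=f'-2\tau_3$ if $\mu\ge1,\iota=0$; $f=f'-(2\tau_2+5\tau_3)$ if $\mu=\iota=0$. For $0\le k\le n/3$: $E_1(n,k)$ has parts $X,Y_1,Y_2$ with $|X|=k$, $|Y_1|=\lceil\frac{n-k}2\rceil$, $|Y_2|=\lfloor\frac{n-k}2\rfloor$, edges all pairs meeting $X$ and all $Y_1$–$Y_2$ pairs, so $e(E_1(n,k))=\binom k2+k(n-k)+\lceil\frac{n-k}2\rceil\lfloor\frac{n-k}2\rfloor$. $E_2(n,k)$ is defined only for $k<\frac{n-1}4$: parts $X,Y_1,Y_2$ with $|X|=2k+1$, $|Y_1|=\lfloor\frac n2\rfloor$, $|Y_2|=\lceil\frac n2\rceil-2k-1$ (or floor/ceiling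 swapped), edges all pairs within $X$ and all pairs between $Y_1$ and $X\cup Y_2$, so $e(E_2(n,k))=\binom{2k+1}2+\lceil\frac n2\rceil\lfloor\frac n2\rfloor$. $E_3(n,k)$ has parts $X,Y_1$ with $|X|=2k+1$, $|Y_1|=n-2k-1$, edges all pairs meeting $X$, so $e(E_3(n,k))=\binom{2k+1}2+(2k+1)(n-2k-1)$. -}

module Defs where

open import Data.Nat using (ℕ; zero; suc; _+_; _*_; _∸_; _≤_; _<_; _⊔_; ⌊_/2⌋; ⌈_/2⌉; _<ᵇ_)
open import Data.Nat.Combinatorics using (_C_)
open import Data.Bool using (if_then_else_)
open import Data.Product using (_×_)
open import Relation.Binary.PropositionalEquality using (_≡_)

f′ : ℕ → ℕ → ℕ → ℕ → ℕ → ℕ → ℕ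
f′ τ₁ τ₂ τ₃ τ₄ μ ι =
  4 * μ * τ₁ + 2 * ι * τ₁ + 7 * (τ₁ C 2) + 3 * τ₁
  + 2 * ι * τ₂ + 8 * (τ₂ C 2) + 3 * τ₂
  + 8 * (τ₃ C 2) + 8 * τ₃ * τ₄ + 3 * τ₃
  + 7 * τ₁ * τ₂ + (2 + 3 * μ) * τ₂
  + 7 * τ₁ * (τ₃ + τ₄) + (3 + 3 * μ) * τ₃
  + 8 * τ₂ * (τ₃ + τ₄) + (2 + ι) * τ₃

-- f, with the case distinction on μ = 0 / ι = 0.
-- The subtracted amounts never exceed f' (f' ≥ 2τ₂ + 8τ₃), so ∸ is exact.
f : ℕ → ℕ → ℕ → ℕ → ℕ → ℕ → ℕ
f τ₁ τ₂ τ₃ τ₄ zero    zero    = f′ τ₁ τ₂ τ₃ τ₄ zero zero ∸ (2 * τ₂ + 5 * τ₃)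
f τ₁ τ₂ τ₃ τ₄ zero    (suc i) = f′ τ₁ τ₂ τ₃ τ₄ zero (suc i) ∸ (2 * τ₂ + 3 * τ₃)
f τ₁ τ₂ τ₃ τ₄ (suc m) zero    = f′ τ₁ τ₂ τ₃ τ₄ (suc m) zero ∸ (2 * τ₃)
f τ₁ τ₂ τ₃ τ₄ (suc m) (suc i) = f′ τ₁ τ₂ τ₃ τ₄ (suc m) (suc i)

InF : ℕ → ℕ → ℕ → ℕ → ℕ → ℕ → ℕ → ℕ → Set
InF n k τ₁ τ₂ τ₃ τ₄ μ ι = (τ₁ + τ₂ + τ₃ + τ₄ ≡ k) × (2 * μ + ι + 3 * k ≡ n)

g : ℕ → ℕ → ℕ → ℕ → ℕ → ℕ → ℕ
g τ₁ τ₂ τ₃ τ₄ μ ι = f τ₁ τ₂ τ₃ τ₄ μ ι + ι * μ + μ * μ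

eE₁ : ℕ → ℕ → ℕ
eE₁ n k = k C 2 + k * (n ∸ k) + ⌈ (n ∸ k) /2⌉ * ⌊ (n ∸ k) /2⌋

eE₂ : ℕ → ℕ → ℕ
eE₂ n k = (2 * k + 1) C 2 + ⌈ n /2⌉ * ⌊ n /2⌋

eE₃ : ℕ → ℕ → ℕ
eE₃ n k = (2 * k + 1) C 2 + (2 * k + 1) * (n ∸ (2 * k + 1))

-- max of e(E_j(n,k)) over the j for which E_j(n,k) is defined
-- (E₂ defined iff k < (n-1)/4, i.e. 4k+1 < n; E₁, E₃ defined under the hypotheses used)
maxE : ℕ → ℕ → ℕ
maxE n k = if 4 * k + 1 <ᵇ n
           then eE₁ n k ⊔ eE₂ n k ⊔ eE₃ n k
           else eE₁ n k ⊔ eE₃ n k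

module Submission where

open import Defs
open import Data.Nat using (ℕ; _+_; _*_; _≤_; _⊔_)
open import Data.Product using (_×_; ∃-syntax; _,_)
open import Data.Sum using (_⊎_)
open import Relation.Binary.PropositionalEquality using (_≡_)

open import Data.Bool using (T; true; false)
open import Data.Nat using (zero; suc; _∸_; _<_; _<ᵇ_; ⌊_/2⌋; ⌈_/2⌉; _/_; _%_; z≤n; s≤s; z<s; _≤?_; _<?_)
open import Data.Nat.Combinatorics using (_C_; nC1≡n; nCk+nC[k+1]≡[n+1]C[k+1])
open import Data.Nat.DivMod using (m≡m%n+[m/n]*n; m%n<n)
open import Data.Nat.Properties
open import Data.Nat.Tactic.RingSolver using (solve-∀)
open import Data.Product using (proj₁)
open import Data.Sum using (inj₁; inj₂)
open import Relation.Nullary using (Dec; ¬_; yes; no; contradiction)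
open import Relation.Binary.PropositionalEquality using (refl; sym; trans; cong; cong₂; subst; module ≡-Reasoning)

-- Write f as a quadratic form in τ plus a linear form τ₁ ℓ₁ + τ₂ ℓ₂ + τ₃ ℓ₃ whose
-- coefficients depend on μ and ι. The quadratic form depends on (τ₂, τ₃) only through τ₂ + τ₃, so
-- moving weight between τ₂ and τ₃ changes f linearly, by the sign of ℓ₂ − ℓ₃: positive if ι ≥ 4,
-- non-positive if ι ≤ 3 and μ ≥ 1. Along τ₁ + τ₂ = t (and along τ₁ + τ₃ = t when τ₂ = τ₄ = 0),
-- f is linear plus the strictly convex (τ₂ choose 2) (resp. (τ₃ choose 2)), so it is maximal only
-- at an endpoint. Hence in (iii) and (iv) only the points (k,0,0,0), (0,k,0,0), (0,0,k,0) matter.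
-- Their values of g are bounded by k C 2 + k (y + z) + y z or (2k+1) C 2 + y z with y + z fixed,
-- which AM-GM (y z ≤ ⌈s/2⌉ ⌊s/2⌋) and unbalancing ((y + d) z ≤ y (d + z) for z ≤ y) compare with
-- e(E₁), e(E₂), e(E₃); balanced choices of μ and ι attain these values.

+≡+⇒≤ : ∀ {x y p q} → x + p ≡ y + q → q ≤ p → x ≤ y
+≡+⇒≤ {x} {y} {p} {q} eq q≤p =
  +-cancelʳ-≤ p x y (subst (_≤ y + p) (sym eq) (+-monoʳ-≤ y q≤p))

+≡+⇒< : ∀ {x y p q} → x + p ≡ y + q → q < p → x < y
+≡+⇒< {x} {y} {p} {q} eq q<p =
  +-cancelʳ-< p x y (subst (_< y + p) (sym eq) (+-monoʳ-< y q<p))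

+≡⇒≤ : ∀ {x y} d → x + d ≡ y → x ≤ y
+≡⇒≤ {x} d refl = m≤m+n x d

m+c≤x+m⇒c≤x : ∀ m {c x} → m + c ≤ x + m → c ≤ x
m+c≤x+m⇒c≤x m {c} {x} le = +-cancelʳ-≤ m c x (subst (_≤ x + m) (+-comm m c) le)

x+0+0≡x : ∀ x → x + 0 + 0 ≡ x
x+0+0≡x x = trans (+-identityʳ (x + 0)) (+-identityʳ x)

*≡*⇒≡0 : ∀ c {u v} → c * v ≡ c * u → u < v → c ≡ 0
*≡*⇒≡0 zero    _  _   = refl
*≡*⇒≡0 (suc c) eq u<v = contradiction (*-cancelˡ-≡ _ _ (suc c) (sym eq)) (<⇒≢ u<v)

C₂-suc : ∀ n → suc n C 2 ≡ n + n C 2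
C₂-suc n = begin
  suc n C 2            ≡⟨ nCk+nC[k+1]≡[n+1]C[k+1] n 1 ⟨
  n C 1 + n C 2        ≡⟨ cong (_+ n C 2) (nC1≡n n) ⟩
  n + n C 2            ∎
  where open ≡-Reasoning

C₂-+ : ∀ m n → (m + n) C 2 ≡ m C 2 + n C 2 + m * n
C₂-+ zero    n = sym (+-identityʳ (n C 2))
C₂-+ (suc m) n = begin
  suc (m + n) C 2                         ≡⟨ C₂-suc (m + n) ⟩
  m + n + (m + n) C 2                     ≡⟨ cong (m + n +_) (C₂-+ m n) ⟩
  m + n + (m C 2 + n C 2 + m * n)         ≡⟨ shuffle m n (m C 2) (n C 2) ⟩
  m + m C 2 + n C 2 + suc m * n           ≡⟨ cong (λ c → c + n C 2 + suc m * n) (C₂-suc m) ⟨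
  suc m C 2 + n C 2 + suc m * n           ∎
  where
  open ≡-Reasoning
  shuffle : ∀ m n x y → m + n + (x + y + m * n) ≡ m + x + y + (1 + m) * n
  shuffle = solve-∀

2*C₂+n≡n*n : ∀ n → 2 * (n C 2) + n ≡ n * n
2*C₂+n≡n*n zero    = refl
2*C₂+n≡n*n (suc n) = begin
  2 * (suc n C 2) + suc n       ≡⟨ cong (λ c → 2 * c + suc n) (C₂-suc n) ⟩
  2 * (n + n C 2) + suc n       ≡⟨ shuffle n (n C 2) ⟩
  (2 * (n C 2) + n) + (2 * n + 1) ≡⟨ cong (_+ (2 * n + 1)) (2*C₂+n≡n*n n) ⟩
  n * n + (2 * n + 1)           ≡⟨ square n ⟩
  suc n * suc n                 ∎
  where
  open ≡-Reasoning
  shuffle : ∀ n c → 2 * (n + c) + suc n ≡ (2 * c + n) + (2 * n + 1)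
  shuffle = solve-∀
  square : ∀ n → n * n + (2 * n + 1) ≡ suc n * suc n
  square = solve-∀

C₂-odd : ∀ k → (2 * k + 1) C 2 ≡ k * (2 * k + 1)
C₂-odd k = *-cancelˡ-≡ _ _ 2 (+-cancelʳ-≡ (2 * k + 1) _ _ (begin
  2 * ((2 * k + 1) C 2) + (2 * k + 1) ≡⟨ 2*C₂+n≡n*n (2 * k + 1) ⟩
  (2 * k + 1) * (2 * k + 1)          ≡⟨ square k ⟩
  2 * (k * (2 * k + 1)) + (2 * k + 1) ∎))
  where
  open ≡-Reasoning
  square : ∀ k → (2 * k + 1) * (2 * k + 1) ≡ 2 * (k * (2 * k + 1)) + (2 * k + 1)
  square = solve-∀

C₂<square : ∀ n → suc n C 2 < suc n * suc n
C₂<square n = +≡⇒≤ (suc n C 2 + n) (begin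
  suc (suc n C 2) + (suc n C 2 + n) ≡⟨ shuffle (suc n C 2) n ⟩
  2 * (suc n C 2) + suc n           ≡⟨ 2*C₂+n≡n*n (suc n) ⟩
  suc n * suc n                     ∎)
  where
  open ≡-Reasoning
  shuffle : ∀ c n → suc c + (c + n) ≡ 2 * c + suc n
  shuffle = solve-∀

-- Lets the ring solver verify identities involving k C 2: treat it as a variable c and
-- discharge the relation 2 c + k = k * k by cancellation.
cancel-C₂ : ∀ a k {x y} → x + a * (k * k) ≡ y + a * (2 * (k C 2) + k) → x ≡ y
cancel-C₂ a k {x} {y} eq =
  +-cancelʳ-≡ (a * (k * k)) x y (trans eq (cong (λ s → y + a * s) (2*C₂+n≡n*n k)))

halfProduct : ℕ → ℕ
halfProduct n = ⌈ n /2⌉ * ⌊ n /2⌋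

halfProduct-+2 : ∀ x → halfProduct (2 + x) ≡ halfProduct x + suc x
halfProduct-+2 x = begin
  suc ⌈ x /2⌉ * suc ⌊ x /2⌋                 ≡⟨ expand ⌈ x /2⌉ ⌊ x /2⌋ ⟩
  halfProduct x + suc (⌊ x /2⌋ + ⌈ x /2⌉)   ≡⟨ cong (λ s → halfProduct x + suc s) (⌊n/2⌋+⌈n/2⌉≡n x) ⟩
  halfProduct x + suc x                     ∎
  where
  open ≡-Reasoning
  expand : ∀ c d → suc c * suc d ≡ c * d + suc (d + c)
  expand = solve-∀

*≤halfProduct : ∀ y z → y * z ≤ halfProduct (y + z)
*≤halfProduct zero    z       = z≤n
*≤halfProduct (suc y) zero    = subst (_≤ halfProduct (suc y + 0)) (sym (*-zeroʳ (suc y))) z≤n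
*≤halfProduct (suc y) (suc z) = begin
  suc y * suc z                    ≡⟨ expand y z ⟩
  y * z + suc (y + z)              ≤⟨ +-monoˡ-≤ (suc (y + z)) (*≤halfProduct y z) ⟩
  halfProduct (y + z) + suc (y + z) ≡⟨ halfProduct-+2 (y + z) ⟨
  halfProduct (2 + (y + z))        ≡⟨ cong halfProduct (cong suc (+-suc y z)) ⟨
  halfProduct (suc y + suc z)      ∎
  where
  open ≤-Reasoning
  expand : ∀ y z → suc y * suc z ≡ y * z + suc (y + z)
  expand = solve-∀

halfProduct-balanced : ∀ y {r} → r ≤ 1 → halfProduct (y + (y + r)) ≡ y * (y + r)
halfProduct-balanced zero    z≤n       = refl
halfProduct-balanced zero    (s≤s z≤n) = refl
halfProduct-balanced (suc y) {r} r≤1 = begin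
  halfProduct (suc y + suc (y + r))      ≡⟨ cong (λ s → halfProduct (suc s)) (+-suc y (y + r)) ⟩
  halfProduct (2 + (y + (y + r)))        ≡⟨ halfProduct-+2 (y + (y + r)) ⟩
  halfProduct (y + (y + r)) + suc (y + (y + r)) ≡⟨ cong (_+ suc (y + (y + r))) (halfProduct-balanced y r≤1) ⟩
  y * (y + r) + suc (y + (y + r))        ≡⟨ expand y r ⟩
  suc y * (suc y + r)                    ∎
  where
  open ≡-Reasoning
  expand : ∀ y r → y * (y + r) + suc (y + (y + r)) ≡ suc y * (suc y + r)
  expand = solve-∀

halving : ∀ x → ∃[ h ] ∃[ r ] (r ≤ 1 × h + (h + r) ≡ x)
halving x = x / 2 , x % 2 , ≤-pred (m%n<n x 2) , (begin
  x / 2 + (x / 2 + x % 2) ≡⟨ shuffle (x / 2) (x % 2) ⟩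
  x % 2 + x / 2 * 2       ≡⟨ m≡m%n+[m/n]*n x 2 ⟨
  x                       ∎)
  where
  open ≡-Reasoning
  shuffle : ∀ h r → h + (h + r) ≡ r + h * 2
  shuffle = solve-∀

*-unbalance-≤ : ∀ {y z} d → z ≤ y → (y + d) * z ≤ y * (d + z)
*-unbalance-≤ {y} {z} d z≤y = begin
  (y + d) * z    ≡⟨ *-distribʳ-+ z y d ⟩
  y * z + d * z  ≤⟨ +-monoʳ-≤ (y * z) (*-monoʳ-≤ d z≤y) ⟩
  y * z + d * y  ≡⟨ shuffle y z d ⟩
  y * (d + z)    ∎
  where
  open ≤-Reasoning
  shuffle : ∀ y z d → y * z + d * y ≡ y * (d + z)
  shuffle = solve-∀

-- If β + b ≤ α the first endpoint wins because b C 2 < b * b; otherwise α < β + b and the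
-- second one wins.
endpoints-dominate : ∀ α β {a b} → 0 < a → 0 < b →
  a * α + b * β + b C 2 < (a + b) * α ⊎
  a * α + b * β + b C 2 < (a + b) * β + (a + b) C 2
endpoints-dominate α β {a@(suc _)} {b@(suc b′)} _ _ with β + b ≤? α
... | yes β+b≤α = inj₁ (+≡+⇒< (shuffle a α b β (b C 2)) (begin-strict
  b * β + b C 2 <⟨ +-monoʳ-< (b * β) (C₂<square b′) ⟩
  b * β + b * b ≡⟨ *-distribˡ-+ b β b ⟨
  b * (β + b)   ≤⟨ *-monoʳ-≤ b β+b≤α ⟩
  b * α         ∎))
  where
  open ≤-Reasoning
  shuffle : ∀ a α b β c → a * α + b * β + c + b * α ≡ (a + b) * α + (b * β + c)
  shuffle = solve-∀
... | no β+b≰α = inj₂ (+≡+⇒< eq (begin-strict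
  a * α             <⟨ *-monoʳ-< a (≰⇒> β+b≰α) ⟩
  a * (β + b)       ≤⟨ m≤m+n (a * (β + b)) (a C 2) ⟩
  a * (β + b) + a C 2 ∎))
  where
  open ≤-Reasoning
  shuffle : ∀ a α b β ca cb → a * α + b * β + cb + (a * (β + b) + ca) ≡ (a + b) * β + (ca + cb + a * b) + a * α
  shuffle = solve-∀
  eq : a * α + b * β + b C 2 + (a * (β + b) + a C 2) ≡ (a + b) * β + (a + b) C 2 + a * α
  eq = trans (shuffle a α b β (a C 2) (b C 2)) (cong (λ c → (a + b) * β + c + a * α) (sym (C₂-+ a b)))

<⊎<⇒≤⊔ : ∀ {x y z} {P : Set} → x < y ⊎ x < z → x ≤ y ⊔ z × (x ≡ y ⊔ z → P)
<⊎<⇒≤⊔ {y = y} {z} (inj₁ x<y) = let x<y⊔z = <-≤-trans x<y (m≤m⊔n y z) in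
  <⇒≤ x<y⊔z , λ eq → contradiction eq (<⇒≢ x<y⊔z)
<⊎<⇒≤⊔ {y = y} {z} (inj₂ x<z) = let x<y⊔z = <-≤-trans x<z (m≤n⊔m y z) in
  <⇒≤ x<y⊔z , λ eq → contradiction eq (<⇒≢ x<y⊔z)

strict-maximum-at-endpoints : ∀ (F : ℕ → ℕ → ℕ) (K : ℕ → ℕ) α β →
  (∀ a b → F a b ≡ K (a + b) + (a * α + b * β + b C 2)) →
  ∀ {a b} → 0 < a → 0 < b → F a b < F (a + b) 0 ⊎ F a b < F 0 (a + b)
strict-maximum-at-endpoints F K α β F≡ {a} {b} 0<a 0<b
  rewrite F≡ a b | F≡ 0 (a + b) | F≡ (a + b) 0 | +-identityʳ (a + b)
  with endpoints-dominate α β 0<a 0<b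
... | inj₁ lt = inj₁ (+-monoʳ-< (K (a + b))
  (subst (a * α + b * β + b C 2 <_) (sym (trans (+-identityʳ _) (+-identityʳ _))) lt))
... | inj₂ lt = inj₂ (+-monoʳ-< (K (a + b)) lt)

maximum-at-endpoints : ∀ (F : ℕ → ℕ → ℕ) (K : ℕ → ℕ) α β →
  (∀ a b → F a b ≡ K (a + b) + (a * α + b * β + b C 2)) → ∀ a b →
  (F a b ≤ F (a + b) 0 ⊔ F 0 (a + b)) × (F a b ≡ F (a + b) 0 ⊔ F 0 (a + b) → a ≡ 0 ⊎ b ≡ 0)
maximum-at-endpoints F K α β F≡ zero    b       = m≤n⊔m _ _ , λ _ → inj₁ refl
maximum-at-endpoints F K α β F≡ (suc a) zero    rewrite +-identityʳ a = m≤m⊔n _ _ , λ _ → inj₂ refl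
maximum-at-endpoints F K α β F≡ (suc a) (suc b) =
  <⊎<⇒≤⊔ (strict-maximum-at-endpoints F K α β F≡ z<s z<s)

sgn : ℕ → ℕ
sgn zero    = 0
sgn (suc _) = 1

sgn≤1 : ∀ n → sgn n ≤ 1
sgn≤1 zero    = z≤n
sgn≤1 (suc _) = s≤s z≤n

quadratic : ℕ → ℕ → ℕ → ℕ → ℕ
quadratic τ₁ τ₂ τ₃ τ₄ = 7 * (τ₁ C 2) + 8 * (τ₂ C 2) + 8 * (τ₃ C 2)
  + 7 * τ₁ * τ₂ + 7 * τ₁ * (τ₃ + τ₄) + 8 * τ₂ * (τ₃ + τ₄) + 8 * τ₃ * τ₄

ι-part : ℕ → ℕ
ι-part ι = sgn ι * (2 + ι)

-- The factors sgn μ and sgn ι realise the case split on μ = 0 and ι = 0 in the definition of f.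
ℓ₁ ℓ₂ ℓ₃ : ℕ → ℕ → ℕ
ℓ₁ μ ι = 4 * μ + 2 * ι + 3
ℓ₂ μ ι = 2 * ι + 3 + sgn μ * (2 + 3 * μ)
ℓ₃ μ ι = 3 + sgn μ * (3 + 3 * μ) + ι-part ι

f′≡ : ∀ τ₁ τ₂ τ₃ τ₄ μ ι → f′ τ₁ τ₂ τ₃ τ₄ μ ι ≡ quadratic τ₁ τ₂ τ₃ τ₄
  + (τ₁ * ℓ₁ μ ι + τ₂ * (2 * ι + 3 + (2 + 3 * μ)) + τ₃ * (3 + (3 + 3 * μ) + (2 + ι)))
f′≡ τ₁ τ₂ τ₃ τ₄ μ ι = regroup τ₁ τ₂ τ₃ τ₄ μ ι (τ₁ C 2) (τ₂ C 2) (τ₃ C 2)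
  where
  regroup : ∀ τ₁ τ₂ τ₃ τ₄ μ ι c₁ c₂ c₃ →
    4 * μ * τ₁ + 2 * ι * τ₁ + 7 * c₁ + 3 * τ₁ + 2 * ι * τ₂ + 8 * c₂ + 3 * τ₂
    + 8 * c₃ + 8 * τ₃ * τ₄ + 3 * τ₃ + 7 * τ₁ * τ₂ + (2 + 3 * μ) * τ₂
    + 7 * τ₁ * (τ₃ + τ₄) + (3 + 3 * μ) * τ₃ + 8 * τ₂ * (τ₃ + τ₄) + (2 + ι) * τ₃
    ≡ 7 * c₁ + 8 * c₂ + 8 * c₃ + 7 * τ₁ * τ₂ + 7 * τ₁ * (τ₃ + τ₄) + 8 * τ₂ * (τ₃ + τ₄) + 8 * τ₃ * τ₄
      + (τ₁ * (4 * μ + 2 * ι + 3) + τ₂ * (2 * ι + 3 + (2 + 3 * μ)) + τ₃ * (3 + (3 + 3 * μ) + (2 + ι)))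
  regroup = solve-∀

f≡ : ∀ τ₁ τ₂ τ₃ τ₄ μ ι → f τ₁ τ₂ τ₃ τ₄ μ ι ≡ quadratic τ₁ τ₂ τ₃ τ₄
  + (τ₁ * ℓ₁ μ ι + τ₂ * ℓ₂ μ ι + τ₃ * ℓ₃ μ ι)
f≡ τ₁ τ₂ τ₃ τ₄ zero zero = trans (cong (_∸ (2 * τ₂ + 5 * τ₃))
  (trans (f′≡ τ₁ τ₂ τ₃ τ₄ 0 0) (shift (quadratic τ₁ τ₂ τ₃ τ₄) (τ₁ * ℓ₁ 0 0) τ₂ τ₃)))
  (m+n∸n≡m _ (2 * τ₂ + 5 * τ₃))
  where
  shift : ∀ q a b c → q + (a + b * 5 + c * 8) ≡ q + (a + b * 3 + c * 3) + (2 * b + 5 * c)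
  shift = solve-∀
f≡ τ₁ τ₂ τ₃ τ₄ zero (suc i) = trans (cong (_∸ (2 * τ₂ + 3 * τ₃))
  (trans (f′≡ τ₁ τ₂ τ₃ τ₄ 0 (suc i))
    (shift (quadratic τ₁ τ₂ τ₃ τ₄) (τ₁ * ℓ₁ 0 (suc i)) τ₂ τ₃ (2 * suc i + 3) (2 + suc i))))
  (m+n∸n≡m _ (2 * τ₂ + 3 * τ₃))
  where
  shift : ∀ q a b c x v → q + (a + b * (x + 2) + c * (3 + 3 + v))
    ≡ q + (a + b * (x + 0) + c * (3 + 0 + 1 * v)) + (2 * b + 3 * c)
  shift = solve-∀
f≡ τ₁ τ₂ τ₃ τ₄ (suc m) zero = trans (cong (_∸ (2 * τ₃))
  (trans (f′≡ τ₁ τ₂ τ₃ τ₄ (suc m) 0)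
    (shift (quadratic τ₁ τ₂ τ₃ τ₄) (τ₁ * ℓ₁ (suc m) 0) τ₂ τ₃ (2 + 3 * suc m) (3 + 3 * suc m))))
  (m+n∸n≡m _ (2 * τ₃))
  where
  shift : ∀ q a b c y u → q + (a + b * (3 + y) + c * (3 + u + 2))
    ≡ q + (a + b * (3 + 1 * y) + c * (3 + 1 * u + 0)) + 2 * c
  shift = solve-∀
f≡ τ₁ τ₂ τ₃ τ₄ (suc m) (suc i) = trans (f′≡ τ₁ τ₂ τ₃ τ₄ (suc m) (suc i))
  (shift (quadratic τ₁ τ₂ τ₃ τ₄) (τ₁ * ℓ₁ (suc m) (suc i)) τ₂ τ₃
    (2 * suc i + 3) (2 + 3 * suc m) (3 + 3 * suc m) (2 + suc i))
  where
  shift : ∀ q a b c x y u v → q + (a + b * (x + y) + c * (3 + u + v))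
    ≡ q + (a + b * (x + 1 * y) + c * (3 + 1 * u + 1 * v))
  shift = solve-∀

quadratic-τ₂τ₃ : ∀ t₁ b c t₄ → quadratic t₁ b c t₄ ≡ quadratic t₁ 0 (b + c) t₄
quadratic-τ₂τ₃ t₁ b c t₄ = begin
  quadratic t₁ b c t₄
    ≡⟨ regroup t₁ b c t₄ (t₁ C 2) (b C 2) (c C 2) ⟩
  q (b C 2 + c C 2 + b * c)
    ≡⟨ cong q (C₂-+ b c) ⟨
  quadratic t₁ 0 (b + c) t₄
    ∎
  where
  open ≡-Reasoning
  q : ℕ → ℕ
  q cₛ = 7 * (t₁ C 2) + 8 * 0 + 8 * cₛ + 7 * t₁ * 0 + 7 * t₁ * (b + c + t₄) + 8 * 0 * (b + c + t₄) + 8 * (b + c) * t₄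
  regroup : ∀ t₁ b c t₄ c₁ c₂ c₃ →
    7 * c₁ + 8 * c₂ + 8 * c₃ + 7 * t₁ * b + 7 * t₁ * (c + t₄) + 8 * b * (c + t₄) + 8 * c * t₄
    ≡ 7 * c₁ + 8 * 0 + 8 * (c₂ + c₃ + b * c) + 7 * t₁ * 0 + 7 * t₁ * (b + c + t₄) + 8 * 0 * (b + c + t₄) + 8 * (b + c) * t₄
  regroup = solve-∀

f-τ₂τ₃ : ∀ t₁ b c t₄ μ ι →
  f t₁ b c t₄ μ ι ≡ quadratic t₁ 0 (b + c) t₄ + (t₁ * ℓ₁ μ ι + b * ℓ₂ μ ι + c * ℓ₃ μ ι)
f-τ₂τ₃ t₁ b c t₄ μ ι =
  trans (f≡ t₁ b c t₄ μ ι) (cong (_+ (t₁ * ℓ₁ μ ι + b * ℓ₂ μ ι + c * ℓ₃ μ ι)) (quadratic-τ₂τ₃ t₁ b c t₄))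

f-τ₁τ₂ : ∀ a b t₃ t₄ μ ι → f a b t₃ t₄ μ ι ≡ 7 * ((a + b) C 2) + f 0 0 t₃ t₄ μ ι
  + (a * (ℓ₁ μ ι + 7 * (t₃ + t₄)) + b * (ℓ₂ μ ι + 8 * (t₃ + t₄)) + b C 2)
f-τ₁τ₂ a b t₃ t₄ μ ι = begin
  f a b t₃ t₄ μ ι
    ≡⟨ f≡ a b t₃ t₄ μ ι ⟩
  quadratic a b t₃ t₄ + (a * ℓ₁ μ ι + b * ℓ₂ μ ι + t₃ * ℓ₃ μ ι)
    ≡⟨ regroup a b t₃ t₄ (ℓ₁ μ ι) (ℓ₂ μ ι) (ℓ₃ μ ι) (a C 2) (b C 2) (t₃ C 2) ⟩
  7 * (a C 2 + b C 2 + a * b) + (quadratic 0 0 t₃ t₄ + t₃ * ℓ₃ μ ι) + rest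
    ≡⟨ cong₂ (λ c r → 7 * c + r + rest) (C₂-+ a b) (f≡ 0 0 t₃ t₄ μ ι) ⟨
  7 * ((a + b) C 2) + f 0 0 t₃ t₄ μ ι + rest
    ∎
  where
  open ≡-Reasoning
  rest = a * (ℓ₁ μ ι + 7 * (t₃ + t₄)) + b * (ℓ₂ μ ι + 8 * (t₃ + t₄)) + b C 2
  regroup : ∀ a b t₃ t₄ l₁ l₂ l₃ c₁ c₂ c₃ →
    7 * c₁ + 8 * c₂ + 8 * c₃ + 7 * a * b + 7 * a * (t₃ + t₄) + 8 * b * (t₃ + t₄) + 8 * t₃ * t₄
      + (a * l₁ + b * l₂ + t₃ * l₃)
    ≡ 7 * (c₁ + c₂ + a * b)
      + (7 * 0 + 8 * 0 + 8 * c₃ + 7 * 0 * 0 + 7 * 0 * (t₃ + t₄) + 8 * 0 * (t₃ + t₄) + 8 * t₃ * t₄ + t₃ * l₃)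
      + (a * (l₁ + 7 * (t₃ + t₄)) + b * (l₂ + 8 * (t₃ + t₄)) + c₂)
  regroup = solve-∀

f-τ₁τ₃ : ∀ a s μ ι → f a 0 s 0 μ ι ≡ 7 * ((a + s) C 2) + (a * ℓ₁ μ ι + s * ℓ₃ μ ι + s C 2)
f-τ₁τ₃ a s μ ι = begin
  f a 0 s 0 μ ι
    ≡⟨ f≡ a 0 s 0 μ ι ⟩
  quadratic a 0 s 0 + (a * ℓ₁ μ ι + 0 * ℓ₂ μ ι + s * ℓ₃ μ ι)
    ≡⟨ regroup a s (ℓ₁ μ ι) (ℓ₃ μ ι) (a C 2) (s C 2) ⟩
  7 * (a C 2 + s C 2 + a * s) + (a * ℓ₁ μ ι + s * ℓ₃ μ ι + s C 2)
    ≡⟨ cong (λ c → 7 * c + (a * ℓ₁ μ ι + s * ℓ₃ μ ι + s C 2)) (C₂-+ a s) ⟨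
  7 * ((a + s) C 2) + (a * ℓ₁ μ ι + s * ℓ₃ μ ι + s C 2)
    ∎
  where
  open ≡-Reasoning
  regroup : ∀ a s l₁ l₃ c₁ c₃ →
    7 * c₁ + 8 * 0 + 8 * c₃ + 7 * a * 0 + 7 * a * (s + 0) + 8 * 0 * (s + 0) + 8 * s * 0 + (a * l₁ + 0 + s * l₃)
    ≡ 7 * (c₁ + c₃ + a * s) + (a * l₁ + s * l₃ + c₃)
  regroup = solve-∀

f-τ₁τ₂-max : ∀ a b t₃ t₄ μ ι →
  (f a b t₃ t₄ μ ι ≤ f (a + b) 0 t₃ t₄ μ ι ⊔ f 0 (a + b) t₃ t₄ μ ι)
  × (f a b t₃ t₄ μ ι ≡ f (a + b) 0 t₃ t₄ μ ι ⊔ f 0 (a + b) t₃ t₄ μ ι → a ≡ 0 ⊎ b ≡ 0)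
f-τ₁τ₂-max a b t₃ t₄ μ ι = maximum-at-endpoints (λ a b → f a b t₃ t₄ μ ι)
  (λ t → 7 * (t C 2) + f 0 0 t₃ t₄ μ ι) _ _ (λ a b → f-τ₁τ₂ a b t₃ t₄ μ ι) a b

f-τ₁τ₃-max : ∀ a s μ ι → f a 0 s 0 μ ι ≤ f (a + s) 0 0 0 μ ι ⊔ f 0 0 (a + s) 0 μ ι
f-τ₁τ₃-max a s μ ι = proj₁ (maximum-at-endpoints (λ a s → f a 0 s 0 μ ι)
  (λ t → 7 * (t C 2)) _ _ (λ a s → f-τ₁τ₃ a s μ ι) a s)

f-τ₃-to-τ₂ : ∀ t₁ b c t₄ μ ι →
  f t₁ b c t₄ μ ι + c * ℓ₂ μ ι ≡ f t₁ (b + c) 0 t₄ μ ι + c * ℓ₃ μ ι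
f-τ₃-to-τ₂ t₁ b c t₄ μ ι = begin
  f t₁ b c t₄ μ ι + c * ℓ₂ μ ι
    ≡⟨ cong (_+ c * ℓ₂ μ ι) (f-τ₂τ₃ t₁ b c t₄ μ ι) ⟩
  q + (t₁ * ℓ₁ μ ι + b * ℓ₂ μ ι + c * ℓ₃ μ ι) + c * ℓ₂ μ ι
    ≡⟨ shift q (t₁ * ℓ₁ μ ι) b c (ℓ₂ μ ι) (ℓ₃ μ ι) ⟩
  q + (t₁ * ℓ₁ μ ι + (b + c) * ℓ₂ μ ι + 0 * ℓ₃ μ ι) + c * ℓ₃ μ ι
    ≡⟨ cong (λ s → quadratic t₁ 0 s t₄ + (t₁ * ℓ₁ μ ι + (b + c) * ℓ₂ μ ι + 0 * ℓ₃ μ ι) + c * ℓ₃ μ ι) (+-identityʳ (b + c)) ⟨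
  quadratic t₁ 0 (b + c + 0) t₄ + (t₁ * ℓ₁ μ ι + (b + c) * ℓ₂ μ ι + 0 * ℓ₃ μ ι) + c * ℓ₃ μ ι
    ≡⟨ cong (_+ c * ℓ₃ μ ι) (f-τ₂τ₃ t₁ (b + c) 0 t₄ μ ι) ⟨
  f t₁ (b + c) 0 t₄ μ ι + c * ℓ₃ μ ι
    ∎
  where
  open ≡-Reasoning
  q = quadratic t₁ 0 (b + c) t₄
  shift : ∀ q a b c l₂ l₃ → q + (a + b * l₂ + c * l₃) + c * l₂ ≡ q + (a + (b + c) * l₂ + 0 * l₃) + c * l₃
  shift = solve-∀

f-τ₂-to-τ₃ : ∀ t₁ b c t₄ μ ι →
  f t₁ b c t₄ μ ι + b * ℓ₃ μ ι ≡ f t₁ 0 (b + c) t₄ μ ι + b * ℓ₂ μ ι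
f-τ₂-to-τ₃ t₁ b c t₄ μ ι = begin
  f t₁ b c t₄ μ ι + b * ℓ₃ μ ι
    ≡⟨ cong (_+ b * ℓ₃ μ ι) (f-τ₂τ₃ t₁ b c t₄ μ ι) ⟩
  q + (t₁ * ℓ₁ μ ι + b * ℓ₂ μ ι + c * ℓ₃ μ ι) + b * ℓ₃ μ ι
    ≡⟨ shift q (t₁ * ℓ₁ μ ι) b c (ℓ₂ μ ι) (ℓ₃ μ ι) ⟩
  q + (t₁ * ℓ₁ μ ι + 0 * ℓ₂ μ ι + (b + c) * ℓ₃ μ ι) + b * ℓ₂ μ ι
    ≡⟨ cong (_+ b * ℓ₂ μ ι) (f-τ₂τ₃ t₁ 0 (b + c) t₄ μ ι) ⟨
  f t₁ 0 (b + c) t₄ μ ι + b * ℓ₂ μ ι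
    ∎
  where
  open ≡-Reasoning
  q = quadratic t₁ 0 (b + c) t₄
  shift : ∀ q a b c l₂ l₃ → q + (a + b * l₂ + c * l₃) + b * l₃ ≡ q + (a + 0 * l₂ + (b + c) * l₃) + b * l₂
  shift = solve-∀

ℓ₃<ℓ₂ : ∀ μ ι → 4 ≤ ι → ℓ₃ μ ι < ℓ₂ μ ι
ℓ₃<ℓ₂ μ ι@(suc i) 4≤ι = +≡+⇒< (shift (sgn μ) μ i) (≤-trans (s≤s (+-monoˡ-≤ 2 (sgn≤1 μ))) 4≤ι)
  where
  shift : ∀ p μ i → 3 + p * (3 + 3 * μ) + 1 * (2 + (1 + i)) + (1 + i) ≡ 2 * (1 + i) + 3 + p * (2 + 3 * μ) + (p + 2)
  shift = solve-∀

2ι≤1+ι-part : ∀ ι → ι ≤ 3 → 2 * ι ≤ 1 + ι-part ι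
2ι≤1+ι-part 0 _ = z≤n
2ι≤1+ι-part 1 _ = m≤m+n 2 2
2ι≤1+ι-part 2 _ = n≤1+n 4
2ι≤1+ι-part 3 _ = ≤-refl
2ι≤1+ι-part (suc (suc (suc (suc _)))) (s≤s (s≤s (s≤s ())))

ℓ₂≤ℓ₃ : ∀ m ι → ι ≤ 3 → ℓ₂ (suc m) ι ≤ ℓ₃ (suc m) ι
ℓ₂≤ℓ₃ m ι ι≤3 = +≡+⇒≤ (shift m ι (ι-part ι)) (2ι≤1+ι-part ι ι≤3)
  where
  shift : ∀ m ι w → 2 * ι + 3 + 1 * (2 + 3 * (1 + m)) + (1 + w) ≡ 3 + 1 * (3 + 3 * (1 + m)) + w + 2 * ι
  shift = solve-∀

f-τ₃-into-τ₂ : ∀ t₁ b c t₄ μ ι → 4 ≤ ι →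
  (f t₁ b c t₄ μ ι ≤ f t₁ (b + c) 0 t₄ μ ι) × (f t₁ b c t₄ μ ι ≡ f t₁ (b + c) 0 t₄ μ ι → c ≡ 0)
f-τ₃-into-τ₂ t₁ b c t₄ μ ι 4≤ι =
  +≡+⇒≤ transfer (*-monoʳ-≤ c (<⇒≤ ℓ₃<ℓ₂′)) ,
  λ eq → *≡*⇒≡0 c (+-cancelˡ-≡ _ _ _ (trans (cong (_+ c * ℓ₂ μ ι) (sym eq)) transfer)) ℓ₃<ℓ₂′
  where
  transfer = f-τ₃-to-τ₂ t₁ b c t₄ μ ι
  ℓ₃<ℓ₂′ = ℓ₃<ℓ₂ μ ι 4≤ι

f-τ₂-into-τ₃ : ∀ a b c m ι → ι ≤ 3 → f a b c 0 (suc m) ι ≤ f a 0 (b + c) 0 (suc m) ι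
f-τ₂-into-τ₃ a b c m ι ι≤3 = +≡+⇒≤ (f-τ₂-to-τ₃ a b c 0 (suc m) ι) (*-monoʳ-≤ b (ℓ₂≤ℓ₃ m ι ι≤3))

e₁ : ℕ → ℕ → ℕ → ℕ
e₁ k y z = k C 2 + k * (y + z) + y * z

e₂ : ℕ → ℕ → ℕ → ℕ
e₂ k y z = (2 * k + 1) C 2 + y * z

maxE-with-E₂ : ∀ n k → 4 * k + 1 < n → maxE n k ≡ eE₁ n k ⊔ eE₂ n k ⊔ eE₃ n k
maxE-with-E₂ n k lt with 4 * k + 1 <ᵇ n | <⇒<ᵇ lt
... | true | _ = refl

maxE-without-E₂ : ∀ n k → ¬ (4 * k + 1 < n) → maxE n k ≡ eE₁ n k ⊔ eE₃ n k
maxE-without-E₂ n k ¬lt with 4 * k + 1 <ᵇ n in eq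
... | false = refl
... | true  = contradiction (<ᵇ⇒< (4 * k + 1) n (subst T (sym eq) _)) ¬lt

eE₁≤maxE : ∀ n k → eE₁ n k ≤ maxE n k
eE₁≤maxE n k with 4 * k + 1 <? n
... | yes lt = subst (eE₁ n k ≤_) (sym (maxE-with-E₂ n k lt))
  (≤-trans (m≤m⊔n (eE₁ n k) (eE₂ n k)) (m≤m⊔n _ (eE₃ n k)))
... | no ¬lt = subst (eE₁ n k ≤_) (sym (maxE-without-E₂ n k ¬lt)) (m≤m⊔n (eE₁ n k) (eE₃ n k))

eE₂≤maxE : ∀ n k → 4 * k + 1 < n → eE₂ n k ≤ maxE n k
eE₂≤maxE n k lt = subst (eE₂ n k ≤_) (sym (maxE-with-E₂ n k lt)) 
  (≤-trans (m≤n⊔m (eE₁ n k) (eE₂ n k)) (m≤m⊔n _ (eE₃ n k)))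

eE₃≤maxE : ∀ n k → eE₃ n k ≤ maxE n k
eE₃≤maxE n k with 4 * k + 1 <? n
... | yes lt = subst (eE₃ n k ≤_) (sym (maxE-with-E₂ n k lt)) (m≤n⊔m (eE₁ n k ⊔ eE₂ n k) (eE₃ n k))
... | no ¬lt = subst (eE₃ n k ≤_) (sym (maxE-without-E₂ n k ¬lt)) (m≤n⊔m (eE₁ n k) (eE₃ n k))

e₁≤eE₁ : ∀ n k y z → y + z ≡ n ∸ k → e₁ k y z ≤ eE₁ n k
e₁≤eE₁ n k y z y+z≡ = subst (λ s → e₁ k y z ≤ k C 2 + k * s + halfProduct s) y+z≡
  (+-monoʳ-≤ (k C 2 + k * (y + z)) (*≤halfProduct y z))

e₁-balanced : ∀ n k y {r} → y + (y + r) ≡ n ∸ k → r ≤ 1 → e₁ k y (y + r) ≡ eE₁ n k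
e₁-balanced n k y {r} y+y+r≡ r≤1 = subst (λ s → e₁ k y (y + r) ≡ k C 2 + k * s + halfProduct s) y+y+r≡
  (cong (k C 2 + k * (y + (y + r)) +_) (sym (halfProduct-balanced y r≤1)))

e₂-balanced : ∀ k y {n r} → y + (y + r) ≡ n → r ≤ 1 → e₂ k y (y + r) ≡ eE₂ n k
e₂-balanced k y refl r≤1 = cong ((2 * k + 1) C 2 +_) (sym (halfProduct-balanced y r≤1))

e₂≤maxE : ∀ n k y z → y + z ≡ n → 2 * k + 1 ≤ y → e₂ k y z ≤ maxE n k
e₂≤maxE n k y z y+z≡n 2k+1≤y with 4 * k + 1 <? n
... | yes lt = ≤-trans (+-monoʳ-≤ ((2 * k + 1) C 2) (subst (λ s → y * z ≤ halfProduct s) y+z≡n (*≤halfProduct y z)))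
                       (eE₂≤maxE n k lt)
... | no ¬lt with m≤n⇒∃[o]m+o≡n 2k+1≤y
...   | d , refl = ≤-trans (+-monoʳ-≤ ((2 * k + 1) C 2) (subst (λ s → (2 * k + 1 + d) * z ≤ (2 * k + 1) * s) d+z≡ (*-unbalance-≤ d z≤2k+1)))
                           (eE₃≤maxE n k)
  where
  d+z≡ : d + z ≡ n ∸ (2 * k + 1)
  d+z≡ = sym (trans (cong (_∸ (2 * k + 1)) (trans (sym y+z≡n) (+-assoc (2 * k + 1) d z))) (m+n∸m≡n (2 * k + 1) (d + z)))
  z≤2k+1 : z ≤ 2 * k + 1
  z≤2k+1 = ≤-trans (m≤n+m z d) (≤-trans (+-cancelˡ-≤ (2 * k + 1) (d + z) (2 * k) (begin
    2 * k + 1 + (d + z) ≡⟨ +-assoc (2 * k + 1) d z ⟨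
    2 * k + 1 + d + z   ≡⟨ y+z≡n ⟩
    n                   ≤⟨ ≮⇒≥ ¬lt ⟩
    4 * k + 1           ≡⟨ split k ⟩
    2 * k + 1 + 2 * k   ∎)) (m≤m+n (2 * k) 1))
    where
    open ≤-Reasoning
    split : ∀ k → 4 * k + 1 ≡ 2 * k + 1 + 2 * k
    split = solve-∀

f-τ₁-only : ∀ k μ ι → f k 0 0 0 μ ι ≡ 7 * (k C 2) + k * ℓ₁ μ ι
f-τ₁-only k μ ι = trans (f≡ k 0 0 0 μ ι) (shuffle k (k C 2) (ℓ₁ μ ι) (ℓ₂ μ ι) (ℓ₃ μ ι))
  where
  shuffle : ∀ k c l₁ l₂ l₃ → 7 * c + 8 * 0 + 8 * 0 + 7 * k * 0 + 7 * k * (0 + 0) + 8 * 0 * (0 + 0) + 8 * 0 * 0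
    + (k * l₁ + 0 * l₂ + 0 * l₃) ≡ 7 * c + k * l₁
  shuffle = solve-∀

f-τ₂-only : ∀ k μ ι → f 0 k 0 0 μ ι ≡ 8 * (k C 2) + k * ℓ₂ μ ι
f-τ₂-only k μ ι = trans (f≡ 0 k 0 0 μ ι) (shuffle k (k C 2) (ℓ₁ μ ι) (ℓ₂ μ ι) (ℓ₃ μ ι))
  where
  shuffle : ∀ k c l₁ l₂ l₃ → 7 * 0 + 8 * c + 8 * 0 + 7 * 0 * k + 7 * 0 * (0 + 0) + 8 * k * (0 + 0) + 8 * 0 * 0
    + (0 * l₁ + k * l₂ + 0 * l₃) ≡ 8 * c + k * l₂
  shuffle = solve-∀

f-τ₃-only : ∀ k μ ι → f 0 0 k 0 μ ι ≡ 8 * (k C 2) + k * ℓ₃ μ ι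
f-τ₃-only k μ ι = trans (f≡ 0 0 k 0 μ ι) (shuffle k (k C 2) (ℓ₁ μ ι) (ℓ₂ μ ι) (ℓ₃ μ ι))
  where
  shuffle : ∀ k c l₁ l₂ l₃ → 7 * 0 + 8 * 0 + 8 * c + 7 * 0 * 0 + 7 * 0 * (k + 0) + 8 * 0 * (k + 0) + 8 * k * 0
    + (0 * l₁ + 0 * l₂ + k * l₃) ≡ 8 * c + k * l₃
  shuffle = solve-∀

e₂≡ : ∀ k y z → e₂ k y z ≡ k * (2 * k + 1) + y * z
e₂≡ k y z = cong (_+ y * z) (C₂-odd k)

g-τ₁-only : ∀ k μ ι → g k 0 0 0 μ ι ≡ e₁ k (μ + k) (μ + ι + k)
g-τ₁-only k μ ι = cancel-C₂ 3 k (trans (cong (λ x → x + ι * μ + μ * μ + 3 * (k * k)) (f-τ₁-only k μ ι))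
  (expand k μ ι (k C 2)))
  where
  expand : ∀ k μ ι c → 7 * c + k * (4 * μ + 2 * ι + 3) + ι * μ + μ * μ + 3 * (k * k)
    ≡ c + k * ((μ + k) + (μ + ι + k)) + (μ + k) * (μ + ι + k) + 3 * (2 * c + k)
  expand = solve-∀

g-τ₂-only : ∀ k m ι → g 0 k 0 0 (suc m) ι ≡ e₂ k (2 * k + 1 + m) (suc m + ι + k)
g-τ₂-only k m ι = trans (cancel-C₂ 4 k (trans (cong (λ x → x + ι * suc m + suc m * suc m + 4 * (k * k)) (f-τ₂-only k (suc m) ι))
  (expand k m ι (k C 2)))) (sym (e₂≡ k (2 * k + 1 + m) (suc m + ι + k)))
  where
  expand : ∀ k m ι c → 8 * c + k * (2 * ι + 3 + 1 * (2 + 3 * (1 + m))) + ι * (1 + m) + (1 + m) * (1 + m) + 4 * (k * k)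
    ≡ k * (2 * k + 1) + (2 * k + 1 + m) * ((1 + m) + ι + k) + 4 * (2 * c + k)
  expand = solve-∀

g-τ₂-only-μ₀ : ∀ k j → g 0 k 0 0 0 (2 + j) ≤ e₂ k (2 * k + 1) (k + 1 + j)
g-τ₂-only-μ₀ k j = +≡⇒≤ (k + 1 + j) (trans (cancel-C₂ 4 k (trans (cong (λ x → x + (2 + j) * 0 + 0 * 0 + (k + 1 + j) + 4 * (k * k)) (f-τ₂-only k 0 (2 + j)))
  (expand k j (k C 2)))) (sym (e₂≡ k (2 * k + 1) (k + 1 + j))))
  where
  expand : ∀ k j c → 8 * c + k * (2 * (2 + j) + 3 + 0) + (2 + j) * 0 + 0 * 0 + (k + 1 + j) + 4 * (k * k)
    ≡ k * (2 * k + 1) + (2 * k + 1) * (k + 1 + j) + 4 * (2 * c + k)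
  expand = solve-∀

2*ι-part≤3ι+3 : ∀ ι → 2 * ι-part ι ≤ 3 * ι + 3
2*ι-part≤3ι+3 zero    = z≤n
2*ι-part≤3ι+3 (suc i) = +≡⇒≤ i (expand i)
  where
  expand : ∀ i → 2 * (1 * (2 + (1 + i))) + i ≡ 3 * (1 + i) + 3
  expand = solve-∀

ι-part-slack : ∀ {k} ι → 12 ≤ k → k * ι-part ι + 3 * ι + 9 ≤ k * (2 * ι + 2)
ι-part-slack {k} zero 12≤k = begin
  k * 0 + 0 + 9 ≡⟨ cong (λ x → x + 0 + 9) (*-zeroʳ k) ⟩
  9             ≤⟨ +≡⇒≤ 15 refl ⟩
  12 * 2        ≤⟨ *-monoˡ-≤ 2 12≤k ⟩
  k * 2         ∎
  where open ≤-Reasoning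
ι-part-slack {k} (suc i) 12≤k = begin
  k * (1 * (2 + suc i)) + 3 * suc i + 9 ≡⟨ regroup k i ⟩
  k * (3 + i) + 3 * (4 + i)             ≤⟨ +-monoʳ-≤ (k * (3 + i)) (≤-trans (+≡⇒≤ (9 * i) (spread i)) (*-monoˡ-≤ (1 + i) 12≤k)) ⟩
  k * (3 + i) + k * (1 + i)             ≡⟨ merge k i ⟩
  k * (2 * suc i + 2)                   ∎
  where
  open ≤-Reasoning
  regroup : ∀ k i → k * (1 * (2 + suc i)) + 3 * suc i + 9 ≡ k * (3 + i) + 3 * (4 + i)
  regroup = solve-∀
  merge : ∀ k i → k * (3 + i) + k * (1 + i) ≡ k * (2 * suc i + 2)
  merge = solve-∀
  spread : ∀ i → 3 * (4 + i) + 9 * i ≡ 12 * (1 + i)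
  spread = solve-∀

g-τ₃-only-≤e₁ : ∀ k m ι → k + 8 ≤ 2 * suc m + ι → g 0 0 k 0 (suc m) ι ≤ e₁ k (suc m + k) (suc m + ι + k)
g-τ₃-only-≤e₁ k m ι k+8≤ = *-cancelˡ-≤ 2 (+≡+⇒≤ doubled slack)
  where
  μ = suc m
  w = ι-part ι
  expand : ∀ k m ι w c →
    2 * (8 * c + k * (3 + 1 * (3 + 3 * (1 + m)) + w) + ι * (1 + m) + (1 + m) * (1 + m)) + k * (2 * (1 + m) + 4 * ι) + 7 * (k * k)
    ≡ 2 * (c + k * ((1 + m + k) + (1 + m + ι + k)) + (1 + m + k) * (1 + m + ι + k)) + k * (k + 5 + 2 * w) + 7 * (2 * c + k)
  expand = solve-∀
  doubled : 2 * g 0 0 k 0 μ ι + k * (2 * μ + 4 * ι) ≡ 2 * e₁ k (μ + k) (μ + ι + k) + k * (k + 5 + 2 * w)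
  doubled = cancel-C₂ 7 k (trans
    (cong (λ x → 2 * (x + ι * μ + μ * μ) + k * (2 * μ + 4 * ι) + 7 * (k * k)) (f-τ₃-only k μ ι))
    (expand k m ι w (k C 2)))
  open ≤-Reasoning
  split : ∀ k ι → k + 5 + (3 * ι + 3) ≡ k + 8 + 3 * ι
  split = solve-∀
  merge : ∀ x ι → x + ι + 3 * ι ≡ x + 4 * ι
  merge = solve-∀
  slack : k * (k + 5 + 2 * w) ≤ k * (2 * μ + 4 * ι)
  slack = *-monoʳ-≤ k (begin
    k + 5 + 2 * w         ≤⟨ +-monoʳ-≤ (k + 5) (2*ι-part≤3ι+3 ι) ⟩
    k + 5 + (3 * ι + 3)   ≡⟨ split k ι ⟩
    k + 8 + 3 * ι         ≤⟨ +-monoˡ-≤ (3 * ι) k+8≤ ⟩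
    2 * μ + ι + 3 * ι     ≡⟨ merge (2 * μ) ι ⟩
    2 * μ + 4 * ι         ∎)

-- y = μ + 2k − 3 and z = μ + ι + k + 3 (with k = 3 + j) leave the slack of ι-part-slack.
g-τ₃-only-≤e₂ : ∀ j m ι → 9 ≤ j →
  g 0 0 (3 + j) 0 (suc m) ι ≤ e₂ (3 + j) (suc m + 2 * j + 3) (suc m + ι + j + 6)
g-τ₃-only-≤e₂ j m ι 9≤j = +≡+⇒≤ shifted (ι-part-slack ι (s≤s (s≤s (s≤s 9≤j))))
  where
  k = 3 + j
  μ = suc m
  w = ι-part ι
  expand : ∀ j m ι w c →
    8 * c + (3 + j) * (3 + 1 * (3 + 3 * (1 + m)) + w) + ι * (1 + m) + (1 + m) * (1 + m) + (3 + j) * (2 * ι + 2) + 4 * ((3 + j) * (3 + j))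
    ≡ (3 + j) * (2 * (3 + j) + 1) + (1 + m + 2 * j + 3) * (1 + m + ι + j + 6) + ((3 + j) * w + 3 * ι + 9) + 4 * (2 * c + (3 + j))
  expand = solve-∀
  shifted : g 0 0 k 0 μ ι + k * (2 * ι + 2) ≡ e₂ k (μ + 2 * j + 3) (μ + ι + j + 6) + (k * w + 3 * ι + 9)
  shifted = trans (cancel-C₂ 4 k (trans
    (cong (λ x → x + ι * μ + μ * μ + k * (2 * ι + 2) + 4 * (k * k)) (f-τ₃-only k μ ι))
    (expand j m ι w (k C 2))))
    (cong (_+ (k * w + 3 * ι + 9)) (sym (e₂≡ k (μ + 2 * j + 3) (μ + ι + j + 6))))

≤⊔-+-+ : ∀ {x y z c d M} → x ≤ y ⊔ z → y + c + d ≤ M → z + c + d ≤ M → x + c + d ≤ M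
≤⊔-+-+ {x} {y} {z} {c} {d} x≤y⊔z y+c+d≤M z+c+d≤M with ⊔-sel y z
... | inj₁ y⊔z≡y = ≤-trans (+-monoˡ-≤ d (+-monoˡ-≤ c (subst (x ≤_) y⊔z≡y x≤y⊔z))) y+c+d≤M
... | inj₂ y⊔z≡z = ≤-trans (+-monoˡ-≤ d (+-monoˡ-≤ c (subst (x ≤_) y⊔z≡z x≤y⊔z))) z+c+d≤M

E₁-parts : ∀ μ ι k → (μ + k) + (μ + ι + k) ≡ (2 * μ + ι + 3 * k) ∸ k
E₁-parts μ ι k = sym (trans (cong (_∸ k) (regroup μ ι k)) (m+n∸n≡m _ k))
  where
  regroup : ∀ μ ι k → 2 * μ + ι + 3 * k ≡ (μ + k) + (μ + ι + k) + k
  regroup = solve-∀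

g-τ₁-only-≤maxE : ∀ k μ ι → g k 0 0 0 μ ι ≤ maxE (2 * μ + ι + 3 * k) k
g-τ₁-only-≤maxE k μ ι = begin
  g k 0 0 0 μ ι                ≡⟨ g-τ₁-only k μ ι ⟩
  e₁ k (μ + k) (μ + ι + k)     ≤⟨ e₁≤eE₁ _ k (μ + k) (μ + ι + k) (E₁-parts μ ι k) ⟩
  eE₁ (2 * μ + ι + 3 * k) k    ≤⟨ eE₁≤maxE _ k ⟩
  maxE (2 * μ + ι + 3 * k) k   ∎
  where open ≤-Reasoning

g-τ₂-only-≤maxE : ∀ k μ ι → 2 ≤ 2 * μ + ι → g 0 k 0 0 μ ι ≤ maxE (2 * μ + ι + 3 * k) k
g-τ₂-only-≤maxE k (suc m) ι _ =
  ≤-trans (≤-reflexive (g-τ₂-only k m ι)) (e₂≤maxE _ k _ (suc m + ι + k) (parts k m ι) (m≤m+n (2 * k + 1) m))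
  where
  parts : ∀ k m ι → (2 * k + 1 + m) + (suc m + ι + k) ≡ 2 * suc m + ι + 3 * k
  parts = solve-∀
g-τ₂-only-≤maxE k zero (suc zero) (s≤s ())
g-τ₂-only-≤maxE k zero (suc (suc j)) _ =
  ≤-trans (g-τ₂-only-μ₀ k j) (e₂≤maxE _ k _ (k + 1 + j) (parts k j) ≤-refl)
  where
  parts : ∀ k j → (2 * k + 1) + (k + 1 + j) ≡ 2 + j + 3 * k
  parts = solve-∀

τ₁τ₂-≤maxE : ∀ n k → 3 * k + 2 ≤ n → ∀ a b μ ι → InF n k a b 0 0 μ ι → g a b 0 0 μ ι ≤ maxE n k
τ₁τ₂-≤maxE _ k 3k+2≤n a b μ ι (a+b≡k , refl) =
  ≤⊔-+-+ (subst (λ s → f a b 0 0 μ ι ≤ f s 0 0 0 μ ι ⊔ f 0 s 0 0 μ ι) a+b≡k′ (proj₁ (f-τ₁τ₂-max a b 0 0 μ ι)))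
    (g-τ₁-only-≤maxE k μ ι)
    (g-τ₂-only-≤maxE k μ ι (m+c≤x+m⇒c≤x (3 * k) 3k+2≤n))
  where
  a+b≡k′ : a + b ≡ k
  a+b≡k′ = trans (sym (x+0+0≡x (a + b))) a+b≡k

Attained : ℕ → ℕ → ℕ → Set
Attained n k v = ∃[ a ] ∃[ b ] ∃[ μ ] ∃[ ι ] (InF n k a b 0 0 μ ι × g a b 0 0 μ ι ≡ v)

attained-⊔ : ∀ {n k x y} → Attained n k x → Attained n k y → Attained n k (x ⊔ y)
attained-⊔ {x = x} {y} (a , b , μ , ι , p , gx) q with ⊔-sel x y
... | inj₁ x⊔y≡x = a , b , μ , ι , p , trans gx (sym x⊔y≡x)
attained-⊔ {x = x} {y} _ (a , b , μ , ι , p , gy) | inj₂ x⊔y≡y = a , b , μ , ι , p , trans gy (sym x⊔y≡y)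

attained-E₁ : ∀ n k → 3 * k ≤ n → Attained n k (eE₁ n k)
attained-E₁ n k 3k≤n with m≤n⇒∃[o]m+o≡n 3k≤n
... | d , 3k+d≡n with halving d
...   | h , r , r≤1 , refl = k , 0 , h , r , (trans (x+0+0≡x (k + 0)) (+-identityʳ k) , trans (regroup h r k) 3k+d≡n) , (begin
  g k 0 0 0 h r              ≡⟨ g-τ₁-only k h r ⟩
  e₁ k (h + k) (h + r + k)   ≡⟨ cong (e₁ k (h + k)) (swap h r k) ⟩
  e₁ k (h + k) (h + k + r)   ≡⟨ e₁-balanced n k (h + k) parts r≤1 ⟩
  eE₁ n k                    ∎)
  where
  open ≡-Reasoning
  regroup : ∀ h r k → 2 * h + r + 3 * k ≡ 3 * k + (h + (h + r))
  regroup = solve-∀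
  swap : ∀ h r k → h + r + k ≡ h + k + r
  swap = solve-∀
  parts : h + k + (h + k + r) ≡ n ∸ k
  parts = trans (cong (h + k +_) (sym (swap h r k)))
    (trans (E₁-parts h r k) (cong (_∸ k) (trans (regroup h r k) 3k+d≡n)))

attained-E₂ : ∀ n k → 4 * k + 1 < n → Attained n k (eE₂ n k)
attained-E₂ n k 4k+1<n with m≤n⇒∃[o]m+o≡n 4k+1<n
... | d , 4k+2+d≡n with halving d
...   | h , r , r≤1 , refl = 0 , k , suc h , k + r , (x+0+0≡x k , trans (regroup h r k) 4k+2+d≡n) , (begin
  g 0 k 0 0 (suc h) (k + r)                         ≡⟨ g-τ₂-only k h (k + r) ⟩
  e₂ k (2 * k + 1 + h) (suc h + (k + r) + k)        ≡⟨ cong (e₂ k (2 * k + 1 + h)) (swap h r k) ⟩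
  e₂ k (2 * k + 1 + h) (2 * k + 1 + h + r)          ≡⟨ e₂-balanced k (2 * k + 1 + h) (trans (parts h r k) 4k+2+d≡n) r≤1 ⟩
  eE₂ n k                                           ∎)
  where
  open ≡-Reasoning
  regroup : ∀ h r k → 2 * suc h + (k + r) + 3 * k ≡ suc (4 * k + 1) + (h + (h + r))
  regroup = solve-∀
  swap : ∀ h r k → suc h + (k + r) + k ≡ 2 * k + 1 + h + r
  swap = solve-∀
  parts : ∀ h r k → 2 * k + 1 + h + (2 * k + 1 + h + r) ≡ suc (4 * k + 1) + (h + (h + r))
  parts = solve-∀

attained-E₃ : ∀ n k → 3 * k + 2 ≤ n → Attained n k (eE₃ n k)
attained-E₃ n k 3k+2≤n with m≤n⇒∃[o]m+o≡n 3k+2≤n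
... | d , refl = 0 , k , 1 , d , (x+0+0≡x k , regroup k d) , (begin
  g 0 k 0 0 1 d                                      ≡⟨ g-τ₂-only k 0 d ⟩
  e₂ k (2 * k + 1 + 0) (1 + d + k)                   ≡⟨ cong₂ (e₂ k) (+-identityʳ (2 * k + 1)) (sym rest) ⟩
  eE₃ (3 * k + 2 + d) k                              ∎)
  where
  open ≡-Reasoning
  regroup : ∀ k d → 2 * 1 + d + 3 * k ≡ 3 * k + 2 + d
  regroup = solve-∀
  split : ∀ k d → 3 * k + 2 + d ≡ (2 * k + 1) + (1 + d + k)
  split = solve-∀
  rest : 3 * k + 2 + d ∸ (2 * k + 1) ≡ 1 + d + k
  rest = trans (cong (_∸ (2 * k + 1)) (split k d)) (m+n∸m≡n (2 * k + 1) (1 + d + k))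

attained-maxE : ∀ n k → 3 * k + 2 ≤ n → Attained n k (maxE n k)
attained-maxE n k 3k+2≤n with 4 * k + 1 <? n
... | yes 4k+1<n = subst (Attained n k) (sym (maxE-with-E₂ n k 4k+1<n))
  (attained-⊔ (attained-⊔ (attained-E₁ n k 3k≤n) (attained-E₂ n k 4k+1<n)) (attained-E₃ n k 3k+2≤n))
  where 3k≤n = ≤-trans (m≤m+n (3 * k) 2) 3k+2≤n
... | no ¬4k+1<n = subst (Attained n k) (sym (maxE-without-E₂ n k ¬4k+1<n))
  (attained-⊔ (attained-E₁ n k 3k≤n) (attained-E₃ n k 3k+2≤n))
  where 3k≤n = ≤-trans (m≤m+n (3 * k) 2) 3k+2≤n

g-τ₃-only-≤maxE-large : ∀ j m ι → 3 ≤ m → 9 ≤ j →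
  g 0 0 (3 + j) 0 (suc m) ι ≤ maxE (2 * suc m + ι + 3 * (3 + j)) (3 + j)
g-τ₃-only-≤maxE-large j m ι 3≤m 9≤j = ≤-trans (g-τ₃-only-≤e₂ j m ι 9≤j)
  (e₂≤maxE _ (3 + j) _ (suc m + ι + j + 6) (parts j m ι) 2k+1≤y)
  where
  parts : ∀ j m ι → (suc m + 2 * j + 3) + (suc m + ι + j + 6) ≡ 2 * suc m + ι + 3 * (3 + j)
  parts = solve-∀
  double : ∀ j → 2 * (3 + j) + 1 ≡ 4 + 2 * j + 3
  double = solve-∀
  2k+1≤y : 2 * (3 + j) + 1 ≤ suc m + 2 * j + 3
  2k+1≤y = subst (_≤ suc m + 2 * j + 3) (sym (double j)) (+-monoˡ-≤ 3 (+-monoˡ-≤ (2 * j) (s≤s 3≤m)))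

g-τ₃-only-≤maxE : ∀ k m ι → 3 ≤ m → 19 ≤ 2 * suc m + ι → g 0 0 k 0 (suc m) ι ≤ maxE (2 * suc m + ι + 3 * k) k
g-τ₃-only-≤maxE k m ι 3≤m 19≤2μ+ι with k + 8 ≤? 2 * suc m + ι
... | yes k+8≤2μ+ι = begin
  g 0 0 k 0 (suc m) ι                  ≤⟨ g-τ₃-only-≤e₁ k m ι k+8≤2μ+ι ⟩
  e₁ k (suc m + k) (suc m + ι + k)     ≤⟨ e₁≤eE₁ _ k (suc m + k) (suc m + ι + k) (E₁-parts (suc m) ι k) ⟩
  eE₁ (2 * suc m + ι + 3 * k) k        ≤⟨ eE₁≤maxE _ k ⟩
  maxE (2 * suc m + ι + 3 * k) k       ∎
  where open ≤-Reasoning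
... | no k+8≰2μ+ι with m≤n⇒∃[o]m+o≡n (+-cancelʳ-≤ 8 12 k (≤-trans (s≤s 19≤2μ+ι) (≰⇒> k+8≰2μ+ι)))
...   | t , refl = g-τ₃-only-≤maxE-large (9 + t) m ι 3≤m (m≤m+n 9 t)

4≤μ : ∀ μ ι → ι ≤ 3 → 21 ≤ 2 * μ + ι → 4 ≤ μ
4≤μ μ ι ι≤3 21≤2μ+ι with 4 ≤? μ
... | yes 4≤μ′ = 4≤μ′
... | no 4≰μ = contradiction 21≤2μ+ι (<⇒≱ (≤-<-trans
  (+-mono-≤ (*-monoʳ-≤ 2 (≤-pred (≰⇒> 4≰μ))) ι≤3) (m≤m+n 10 11)))

τ₁τ₂τ₃-≤maxE-small-ι : ∀ k a b c μ ι → a + (b + c) ≡ k → 4 ≤ μ → ι ≤ 3 → 19 ≤ 2 * μ + ι →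
  g a b c 0 μ ι ≤ maxE (2 * μ + ι + 3 * k) k
τ₁τ₂τ₃-≤maxE-small-ι k a b c (suc m) ι a+[b+c]≡k (s≤s 3≤m) ι≤3 19≤2μ+ι = ≤⊔-+-+
  (≤-trans (f-τ₂-into-τ₃ a b c m ι ι≤3)
    (subst (λ s → f a 0 (b + c) 0 (suc m) ι ≤ f s 0 0 0 (suc m) ι ⊔ f 0 0 s 0 (suc m) ι) a+[b+c]≡k
      (f-τ₁τ₃-max a (b + c) (suc m) ι)))
  (g-τ₁-only-≤maxE k (suc m) ι)
  (g-τ₃-only-≤maxE k m ι 3≤m 19≤2μ+ι)

τ₁τ₂τ₃-≤maxE : ∀ n k → 3 * k + 21 ≤ n → ∀ a b c μ ι → InF n k a b c 0 μ ι → g a b c 0 μ ι ≤ maxE n k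
τ₁τ₂τ₃-≤maxE _ k 3k+21≤n a b c μ ι (a+b+c+0≡k , refl) = by-ι (4 ≤? ι)
  where
  a+[b+c]≡k : a + (b + c) ≡ k
  a+[b+c]≡k = trans (sym (+-assoc a b c)) (trans (sym (+-identityʳ (a + b + c))) a+b+c+0≡k)
  21≤2μ+ι : 21 ≤ 2 * μ + ι
  21≤2μ+ι = m+c≤x+m⇒c≤x (3 * k) 3k+21≤n
  by-ι : Dec (4 ≤ ι) → g a b c 0 μ ι ≤ maxE (2 * μ + ι + 3 * k) k
  by-ι (yes 4≤ι) = ≤-trans (+-monoˡ-≤ (μ * μ) (+-monoˡ-≤ (ι * μ) (proj₁ (f-τ₃-into-τ₂ a b c 0 μ ι 4≤ι))))
    (τ₁τ₂-≤maxE _ k (≤-trans (+-monoʳ-≤ (3 * k) (m≤m+n 2 19)) 3k+21≤n) a (b + c) μ ι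
      (trans (x+0+0≡x (a + (b + c))) a+[b+c]≡k , refl))
  by-ι (no 4≰ι) = τ₁τ₂τ₃-≤maxE-small-ι k a b c μ ι a+[b+c]≡k (4≤μ μ ι ι≤3 21≤2μ+ι) ι≤3 (≤-trans (m≤m+n 19 2) 21≤2μ+ι)
    where
    ι≤3 : ι ≤ 3
    ι≤3 = ≤-pred (≰⇒> 4≰ι)

lemmaA1 : ∀ (τ₁ τ₂ τ₃ τ₄ μ ι n k : ℕ) →
      -- (i)
      ( (f τ₁ τ₂ τ₃ τ₄ μ ι ≤ f (τ₁ + τ₂) 0 τ₃ τ₄ μ ι ⊔ f 0 (τ₁ + τ₂) τ₃ τ₄ μ ι)
        × (f τ₁ τ₂ τ₃ τ₄ μ ι ≡ f (τ₁ + τ₂) 0 τ₃ τ₄ μ ι ⊔ f 0 (τ₁ + τ₂) τ₃ τ₄ μ ι →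
           τ₁ ≡ 0 ⊎ τ₂ ≡ 0) )
      -- (ii)
    × ( 4 ≤ ι →
        (f τ₁ τ₂ τ₃ τ₄ μ ι ≤ f τ₁ (τ₂ + τ₃) 0 τ₄ μ ι)
        × (f τ₁ τ₂ τ₃ τ₄ μ ι ≡ f τ₁ (τ₂ + τ₃) 0 τ₄ μ ι → τ₃ ≡ 0) )
      -- (iii)
    × ( 3 * k + 2 ≤ n →
        (∀ (a b m i : ℕ) → InF n k a b 0 0 m i → g a b 0 0 m i ≤ maxE n k)
        × (∃[ a ] ∃[ b ] ∃[ m ] ∃[ i ] (InF n k a b 0 0 m i × g a b 0 0 m i ≡ maxE n k)) )
      -- (iv)
    × ( 3 * k + 21 ≤ n →
        (∀ (a b c m i : ℕ) → InF n k a b c 0 m i → g a b c 0 m i ≤ maxE n k)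
        × (∃[ a ] ∃[ b ] ∃[ c ] ∃[ m ] ∃[ i ] (InF n k a b c 0 m i × g a b c 0 m i ≡ maxE n k)) )
lemmaA1 τ₁ τ₂ τ₃ τ₄ μ ι n k =
    f-τ₁τ₂-max τ₁ τ₂ τ₃ τ₄ μ ι
  , f-τ₃-into-τ₂ τ₁ τ₂ τ₃ τ₄ μ ι
  , (λ 3k+2≤n → τ₁τ₂-≤maxE n k 3k+2≤n , attained-maxE n k 3k+2≤n)
  , (λ 3k+21≤n → τ₁τ₂τ₃-≤maxE n k 3k+21≤n , τ₃-free (attained-maxE n k (≤-trans (+-monoʳ-≤ (3 * k) (m≤m+n 2 19)) 3k+21≤n)))
  where
  τ₃-free : Attained n k (maxE n k) → ∃[ a ] ∃[ b ] ∃[ c ] ∃[ m ] ∃[ i ] (InF n k a b c 0 m i × g a b c 0 m i ≡ maxE n k)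
  τ₃-free (a , b , m , i , p) = a , b , 0 , m , i , p
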